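{- Let $\Gamma=(\pi,\mathcal{C},\Sigma)$ be a concrete data type definition, $\mathcal{E}$ a finite set of equations between terms of sort $\pi$ (possibly with variables), and $\mathcal{F}=(f_C)_{C\in\mathcal{C}}$ a family of construction functions that is valid with respect to $\mathcal{E}$. Then the normalization function $f$ associated to $\mathcal{F}$ is a valid normalization function for $(\Gamma,\mathcal{E})$, i.e. (correctness) $f(t)=_\mathcal{E} t$ for all $t\in\mathcal{T}_\pi$, and (completeness) $f(t)=f(u)$ for all $t,u\in\mathcal{T}_\pi$ with $t=_\mathcal{E}u$.
   Context: Fix a set $\mathcal{S}_0$ of primitive sorts and a set $\mathcal{C}_0$ of primitive constants, each having a sort in $\mathcal{S}_0$. A concrete data type definition is a triple $\Gamma=(\pi,\mathcal{C},\Sigma)$ where $\pi\notin\mathcal{S}_0$ is a sort, $\mathcal{C}$ is a non-empty set of constructor symbols, and $\Sigma$ assigns to every $C\in\mathcal{C}$ a sequence $\sigma_1\ldots\sigma_n\pi$ ($n\ge0$, each $\sigma_i\in\mathcal{S}_0\cup\{\pi\}$), written $C:\sigma_1\ldots\sigma_n\pi$. $\mathcal{T}_\sigma$ is the set of variable-free well-sorted terms of sort $\sigma$ over $\mathcal{C}_0\cup\mathcal{C}$; terms with sorted variables are also allowed in equations. $=_\mathcal{E}$ is the smallest congruence on terms containing $\mathcal{E}$ (closed under substitution instances, contexts, reflexivity, symmetry, transitivity). A family of construction functions is $\mathcal{F}=(f_C)_{C\in\mathcal{C}}$ with $f_C:\mathcal{T}_{\sigma_1}\times\cdots\times\mathcal{T}_{\sigma_n}\to\mathcal{T}_\pi$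 for $C:\sigma_1\ldots\sigma_n\pi$. Values: $\mathrm{Val}(\sigma)=\mathcal{T}_\sigma$ for $\sigma\in\mathcal{S}_0$, and $\mathrm{Val}(\pi)$ is the smallest set containing $f_C(v_1,\ldots,v_n)$ for every $C:\sigma_1\ldots\sigma_n\pi$ and $v_i\in\mathrm{Val}(\sigma_i)$. $\mathcal{F}$ is valid with respect to $\mathcal{E}$ if (correctness) for all $C:\sigma_1\ldots\sigma_n\pi$ and $v_i\in\mathrm{Val}(\sigma_i)$, $f_C(v_1,\ldots,v_n)=_\mathcal{E}C(v_1,\ldots,v_n)$; and (completeness) for all $C:\sigma_1\ldots\sigma_n\pi$, $v_i\in\mathrm{Val}(\sigma_i)$, $D:\tau_1\ldots\tau_p\pi$, $w_j\in\mathrm{Val}(\tau_j)$, if $C(v_1,\ldots,v_n)=_\mathcal{E}D(w_1,\ldots,w_p)$ then $f_C(v_1,\ldots,v_n)=f_D(w_1,\ldots,w_p)$ (syntactic equality). The normalization function associated to $\mathcal{F}$ is $f:\mathcal{T}_\pi\to\mathcal{T}_\pi$ defined recursively by $f(C(t_1,\ldots,t_n))=f_C(f(t_1),\ldots,f(t_n))$, with $f$ acting as the identity on arguments of primitive sort. -}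

module Defs where

open import Data.Nat using (ℕ)
open import Data.Empty using (⊥; ⊥-elim)
open import Data.List using (List; []; _∷_)
open import Data.List.Membership.Propositional using (_∈_)
open import Data.Product using (_×_; _,_)
open import Relation.Binary.PropositionalEquality using (_≡_)

data Sort (S0 : Set) : Set where
  prim : S0 → Sort S0
  π    : Sort S0

-- A concrete data type definition Γ = (π, 𝒞, Σ), together with the fixed
-- primitive sorts S0 and primitive constants C0 (each with a sort in S0).
record DataType : Set₁ where
  field
    S0        : Set
    C0        : Set
    sortC0    : C0 → S0
    Con       : Set
    nonempty  : Con
    arity     : Con → List (Sort S0) -- Σ(C) = σ₁ … σₙ π  (the list σ₁ … σₙ)

module Sig (Γ : DataType) where
  open DataType Γ public

  mutual
    data Term (X : Sort S0 → Set) : Sort S0 → Set where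
      var   : ∀ {σ} → X σ → Term X σ
      const : (c : C0) → Term X (prim (sortC0 c))
      con   : (C : Con) → Args X (arity C) → Term X π

    data Args (X : Sort S0 → Set) : List (Sort S0) → Set where
      []  : Args X []
      _∷_ : ∀ {σ σs} → Term X σ → Args X σs → Args X (σ ∷ σs)

  Var : Sort S0 → Set
  Var _ = ℕ

  NoVar : Sort S0 → Set
  NoVar _ = ⊥

  𝒯 : Sort S0 → Set
  𝒯 σ = Term NoVar σ

  𝒯s : List (Sort S0) → Set
  𝒯s σs = Args NoVar σs

  OTerm : Sort S0 → Set
  OTerm σ = Term Var σ

  mutual
    embed : ∀ {σ} → 𝒯 σ → OTerm σ
    embed (var ())
    embed (const c) = const c
    embed (con C ts) = con C (embedArgs ts)

    embedArgs : ∀ {σs} → 𝒯s σs → Args Var σs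
    embedArgs [] = []
    embedArgs (t ∷ ts) = embed t ∷ embedArgs ts

  Subst : Set
  Subst = ∀ {σ} → ℕ → OTerm σ

  mutual
    _[_] : ∀ {σ} → OTerm σ → Subst → OTerm σ
    var x [ s ] = s x
    const c [ s ] = const c
    con C ts [ s ] = con C (ts [ s ]*)

    _[_]* : ∀ {σs} → Args Var σs → Subst → Args Var σs
    [] [ s ]* = []
    (t ∷ ts) [ s ]* = (t [ s ]) ∷ (ts [ s ]*)

  Equations : Set
  Equations = List (OTerm π × OTerm π)

  mutual
    data _⊢_≈_ (E : Equations) : ∀ {σ} → OTerm σ → OTerm σ → Set where
      ax    : ∀ {l r} → (l , r) ∈ E → E ⊢ l ≈ r
      inst  : ∀ {σ} {t u : OTerm σ} (s : Subst) → E ⊢ t ≈ u → E ⊢ (t [ s ]) ≈ (u [ s ])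
      refl  : ∀ {σ} {t : OTerm σ} → E ⊢ t ≈ t
      sym   : ∀ {σ} {t u : OTerm σ} → E ⊢ t ≈ u → E ⊢ u ≈ t
      trans : ∀ {σ} {t u v : OTerm σ} → E ⊢ t ≈ u → E ⊢ u ≈ v → E ⊢ t ≈ v
      cong  : ∀ (C : Con) {ts us : Args Var (arity C)} → E ⊢ ts ≈* us → E ⊢ con C ts ≈ con C us

    data _⊢_≈*_ (E : Equations) : ∀ {σs} → Args Var σs → Args Var σs → Set where
      []  : E ⊢ [] ≈* []
      _∷_ : ∀ {σ σs} {t u : OTerm σ} {ts us : Args Var σs} →
            E ⊢ t ≈ u → E ⊢ ts ≈* us → E ⊢ (t ∷ ts) ≈* (u ∷ us)

  Family : Set
  Family = (C : Con) → 𝒯s (arity C) → 𝒯 π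

  mutual
    data Val (F : Family) : ∀ σ → 𝒯 σ → Set where
      prim : ∀ {s} (t : 𝒯 (prim s)) → Val F (prim s) t
      fval : ∀ (C : Con) {vs : 𝒯s (arity C)} → Vals F (arity C) vs → Val F π (F C vs)

    data Vals (F : Family) : ∀ σs → 𝒯s σs → Set where
      []  : Vals F [] []
      _∷_ : ∀ {σ σs} {v : 𝒯 σ} {vs : 𝒯s σs} → Val F σ v → Vals F σs vs → Vals F (σ ∷ σs) (v ∷ vs)

  record ValidFamily (E : Equations) (F : Family) : Set where
    field
      correct  : ∀ (C : Con) (vs : 𝒯s (arity C)) → Vals F (arity C) vs →
                 E ⊢ embed (F C vs) ≈ embed (con C vs)
      complete : ∀ (C : Con) (vs : 𝒯s (arity C)) (D : Con) (ws : 𝒯s (arity D)) →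
                 Vals F (arity C) vs → Vals F (arity D) ws →
                 E ⊢ embed (con C vs) ≈ embed (con D ws) → F C vs ≡ F D ws

  mutual
    norm : Family → ∀ {σ} → 𝒯 σ → 𝒯 σ
    norm F (var ())
    norm F (const c) = const c
    norm F (con C ts) = F C (normArgs F ts)

    normArgs : Family → ∀ {σs} → 𝒯s σs → 𝒯s σs
    normArgs F [] = []
    normArgs F (t ∷ ts) = norm F t ∷ normArgs F ts

  record ValidNormalization (E : Equations) (f : 𝒯 π → 𝒯 π) : Set where
    field
      correct  : ∀ (t : 𝒯 π) → E ⊢ embed (f t) ≈ embed t
      complete : ∀ (t u : 𝒯 π) → E ⊢ embed t ≈ embed u → f t ≡ f u

{-# OPTIONS --safe #-}
module Submission where

open import Defs
open import Relation.Binary.PropositionalEquality using (_≡_)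

module _ (Γ : DataType) where
  open Sig Γ

  module _ (F : Family) where
    mutual
      norm-Val : ∀ {σ} (t : 𝒯 σ) → Val F σ (norm F t)
      norm-Val (var ())
      norm-Val (const c)  = prim (const c)
      norm-Val (con C ts) = fval C (normArgs-Vals ts)

      normArgs-Vals : ∀ {σs} (ts : 𝒯s σs) → Vals F σs (normArgs F ts)
      normArgs-Vals []       = []
      normArgs-Vals (t ∷ ts) = norm-Val t ∷ normArgs-Vals ts

  module _ {E : Equations} {F : Family} (valid : ValidFamily E F) where
    open ValidFamily valid

    mutual
      norm-correct : ∀ {σ} (t : 𝒯 σ) → E ⊢ embed (norm F t) ≈ embed t
      norm-correct (var ())
      norm-correct (const c)  = refl
      norm-correct (con C ts) =
        trans (correct C (normArgs F ts) (normArgs-Vals F ts)) (cong C (normArgs-correct ts))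

      normArgs-correct : ∀ {σs} (ts : 𝒯s σs) → E ⊢ embedArgs (normArgs F ts) ≈* embedArgs ts
      normArgs-correct []       = []
      normArgs-correct (t ∷ ts) = norm-correct t ∷ normArgs-correct ts

    -- The arguments of C and D normalise to values E-equal to the original ones,
    -- so con C (normArgs ts) =_E con D (normArgs us), and completeness of F applies.
    norm-complete : ∀ (t u : 𝒯 π) → E ⊢ embed t ≈ embed u → norm F t ≡ norm F u
    norm-complete (var ()) _ _
    norm-complete (con C ts) (var ()) _
    norm-complete (con C ts) (con D us) t≈u =
      complete C (normArgs F ts) D (normArgs F us) (normArgs-Vals F ts) (normArgs-Vals F us)
        (trans (cong C (normArgs-correct ts)) (trans t≈u (sym (cong D (normArgs-correct us)))))

    norm-valid : ValidNormalization E (norm F)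
    norm-valid = record { correct = norm-correct ; complete = norm-complete }

theorem1 : (Γ : DataType) (E : Sig.Equations Γ) (F : Sig.Family Γ) →
    Sig.ValidFamily Γ E F → Sig.ValidNormalization Γ E (Sig.norm Γ F)
theorem1 Γ E F = norm-valid Γ
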